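{- Let $\mathbb K$ be the finite field with $q$ elements and $\pi$ a set partition of $[n]$. Then $$|\mathcal J_\pi|=(q-1)^{d(\pi)}q^{2\dim(\pi)-2d(\pi)-\mathrm{crs}(\pi)},$$ equivalently $\mathrm{SPl}_n(\pi)=|\mathcal J_\pi|/|U_n|$.
   Context: $U_n=U_n(\mathbb K)$ is the group of $n\times n$ upper unitriangular matrices over $\mathbb K$; $|U_n|=q^{n(n-1)/2}$. For a set partition $\pi$ of $[n]=\{1,\dots,n\}$, a pair $(i,j)$ with $i<j$ is an arc if $i,j$ are in the same block and no element of that block lies strictly between them; $D(\pi)$ is the set of arcs, $d(\pi)=|D(\pi)|$, $\dim(\pi)=\sum_{(i,j)\in D(\pi)}(j-i)$, and $\mathrm{crs}(\pi)$ is the number of unordered pairs of arcs $(i,j),(k,l)$ with $i<k<j<l$. A pair $(i,j)$, $1\le i<j\le n$, is $\pi$-regular if there is no $k<i$ with $(k,j)\in D(\pi)$ and no $l>j$ with $(i,l)\in D(\pi)$; otherwise it is $\pi$-singular. $\mathcal J_\pi\subseteq U_n$ is the set of matrices $A$ with $A_{i,j}\ne0$ for $(i,j)\in D(\pi)$, $A_{i,j}=0$ for $\pi$-regular $(i,j)\notin D(\pi)$, and $A_{i,j}\in\mathbb K$ arbitrary for $\pi$-singular $(i,j)$. The superplancherel measure (of the supercharacter theory of $U_n$ indexed by set partitions) is $\mathrm{SPl}_n(\pi)=q^{ -n(n-1)/2}(q-1)^{d(\pi)}q^{2\dim(\pi)-2d(\pi)-\mathrm{crs}(\pi)}$. -}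

module Defs where

open import Level using (Level; 0ℓ; _⊔_) renaming (suc to lsuc)
open import Data.Nat using (ℕ; zero; suc; _∸_)
open import Data.Fin using (Fin; toℕ; _<_; _<?_)
open import Data.Fin.Properties using (all?; any?; _≟_)
open import Data.List using (List; []; _∷_; length; map; filter; allFin; cartesianProduct)
open import Data.Nat.ListAction using (sum)
open import Data.Product using (_×_; _,_; Σ; ∃; ∃-syntax; proj₁; proj₂)
open import Relation.Nullary using (¬_; Dec; yes; no)
open import Relation.Nullary.Decidable using (_×-dec_; ¬?)
open import Relation.Binary using (Rel; IsEquivalence; Setoid)
open import Data.Empty using (⊥-elim)
open import Relation.Binary.PropositionalEquality as ≡ using (_≡_)
open import Algebra.Bundles using (CommutativeRing)
open import Function.Bundles using (Bijection)

record FiniteField (c ℓ : Level) (q : ℕ) : Set (lsuc (c ⊔ ℓ)) where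
  field
    commRing : CommutativeRing c ℓ
  open CommutativeRing commRing public
  field
    0≉1     : ¬ (0# ≈ 1#)
    inverse : ∀ x → ¬ (x ≈ 0#) → ∃[ y ] (x * y ≈ 1#)
    card    : Bijection setoid (≡.setoid (Fin q))

-- Set partitions of [n] = Fin n, given as a (decidable) equivalence
-- relation "lie in the same block".

record SetPartition (n : ℕ) : Set₁ where
  field
    _∼_           : Rel (Fin n) 0ℓ
    isEquivalence : IsEquivalence _∼_
    _∼?_          : ∀ i j → Dec (i ∼ j)

module _ {n : ℕ} (π : SetPartition n) where
  open SetPartition π

  Arc : Fin n → Fin n → Set
  Arc i j = (i < j) × (i ∼ j) × (∀ k → i < k → k < j → ¬ (i ∼ k))

  Arc? : ∀ i j → Dec (Arc i j)
  Arc? i j = (i <? j) ×-dec ((i ∼? j) ×-dec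
               all? (λ k → imp? (i <? k) (imp? (k <? j) (¬? (i ∼? k)))))
    where
    imp? : ∀ {A : Set} {B : Set} → Dec A → Dec B → Dec (A → B)
    imp? _       (yes b) = yes (λ _ → b)
    imp? (yes a) (no ¬b) = no (λ f → ¬b (f a))
    imp? (no ¬a) _       = yes (λ a → ⊥-elim (¬a a))

  allPairs : List (Fin n × Fin n)
  allPairs = cartesianProduct (allFin n) (allFin n)

  arcs : List (Fin n × Fin n)
  arcs = filter (λ p → Arc? (proj₁ p) (proj₂ p)) allPairs

  d : ℕ
  d = length arcs

  dim : ℕ
  dim = sum (map (λ p → toℕ (proj₂ p) ∸ toℕ (proj₁ p)) arcs)

  -- crs(π): pairs of arcs (i,j),(k,l) with i < k < j < l (each unordered
  -- pair is counted once, since the pattern fixes which arc comes first)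
  Crossing : (Fin n × Fin n) × (Fin n × Fin n) → Set
  Crossing ((i , j) , (k , l)) = (i < k) × (k < j) × (j < l)

  Crossing? : ∀ x → Dec (Crossing x)
  Crossing? ((i , j) , (k , l)) = (i <? k) ×-dec ((k <? j) ×-dec (j <? l))

  crs : ℕ
  crs = length (filter Crossing? (cartesianProduct arcs arcs))

  Regular : Fin n → Fin n → Set
  Regular i j = (i < j) × ¬ (∃[ k ] (k < i × Arc k j)) × ¬ (∃[ l ] (j < l × Arc i l))

  Singular : Fin n → Fin n → Set
  Singular i j = (i < j) × ¬ Regular i j

module _ {c ℓ : Level} {q : ℕ} (K : FiniteField c ℓ q) {n : ℕ} where
  open FiniteField K

  Matrix : Set c
  Matrix = Fin n → Fin n → Carrier

  IsUnitriangular : Matrix → Set ℓ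
  IsUnitriangular A = (∀ i → A i i ≈ 1#) × (∀ i j → j < i → A i j ≈ 0#)

  -- membership in J_π (for A ∈ U_n); π-singular entries are unconstrained
  InJ : SetPartition n → Matrix → Set ℓ
  InJ π A = IsUnitriangular A
          × (∀ i j → Arc π i j → ¬ (A i j ≈ 0#))
          × (∀ i j → Regular π i j → ¬ Arc π i j → A i j ≈ 0#)

  J-setoid : SetPartition n → Setoid (c ⊔ ℓ) ℓ
  J-setoid π = record
    { Carrier = Σ Matrix (InJ π)
    ; _≈_ = λ A B → ∀ i j → proj₁ A i j ≈ proj₁ B i j
    ; isEquivalence = record
      { refl  = λ i j → refl
      ; sym   = λ p i j → sym (p i j)
      ; trans = λ p r i j → trans (p i j) (r i j) } }

HasCard : ∀ {a b} → Setoid a b → ℕ → Set (a ⊔ b)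
HasCard S N = Bijection S (≡.setoid (Fin N))

module Submission where

-- We count J_π entry by entry.  Each entry (i , j) is subject to exactly
-- one constraint: 1 on the diagonal, 0 below it and at π-regular
-- non-arcs, nonzero at arcs, free at π-singular pairs.  Hence J_π is in
-- bijection with a product of n² sets of sizes 1, q - 1 and q, and
-- |J_π| = (q - 1)^d(π) · q^s(π) with s(π) the number of singular pairs.
-- It remains to show s = 2 dim - 2 d - crs.  A pair i < j is singular
-- iff it is left-blocked (an arc (k , j), k < i) or right-blocked (an arc
-- (i , l), j < l).  A point ends (starts) at most one arc, so left- and
-- right-blocked pairs are each counted by Σ_{arcs (k,j)} (j - k - 1) =
-- dim - d, and doubly blocked pairs are the crossings; inclusion–exclusion
-- gives s + crs = 2 (dim - d).

open import Defs
open import Level using (Level; _⊔_; Lift; lift)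
open import Data.Bool using (true; false; if_then_else_)
open import Data.Unit using (⊤; tt)
open import Data.Empty using (⊥-elim)
open import Data.Nat using (ℕ; zero; suc; _+_; _*_; _∸_; _^_)
open import Data.Nat.Properties
  using (+-*-semiring; *-1-commutativeMonoid; ^-distribˡ-+-*; +-identityʳ; *-identityˡ; *-identityʳ; *-zeroʳ;
         *-distribˡ-+; m+n∸n≡m; +-∸-assoc)
open import Data.Nat.Tactic.RingSolver using (solve-∀)
open import Data.Fin using (Fin; zero; suc; toℕ; _<_; _<?_; punchIn; punchOut; combine; remQuot)
open import Data.Fin.Properties
  using (any?; <-cmp; <-irrefl; <-asym; punchInᵢ≢i; punchOut-cong; punchOut-punchIn; punchIn-punchOut;
         remQuot-combine; combine-remQuot)
open import Data.Vec.Functional using (removeAt)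
open import Data.List using ([]; _∷_; _++_; length; map; filter; allFin; tabulate; cartesianProduct)
open import Data.List.Properties using (map-++; map-tabulate; map-∘)
open import Data.Nat.ListAction using () renaming (sum to listSum)
open import Data.Nat.ListAction.Properties using () renaming (sum-++ to listSum-++)
open import Data.Product using (Σ; _×_; _,_; proj₁; proj₂; ∃-syntax)
open import Data.Sum using (_⊎_; inj₁; inj₂; [_,_])
open import Function using (_∘_; id)
open import Function.Bundles using (Inverse; Bijection)
open import Function.Properties.Bijection using (Bijection⇒Inverse)
open import Function.Properties.Inverse using (Inverse⇒Bijection)
import Function.Construct.Composition as Compose
open import Relation.Nullary using (¬_; Dec; yes; no; does)
open import Relation.Nullary.Decidable using (_×-dec_; ¬?; dec-true; dec-false)
open import Relation.Unary using (Pred; Decidable)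
open import Relation.Binary using (Setoid; IsEquivalence; tri<; tri≈; tri>)
import Relation.Binary.Construct.On as On
open import Relation.Binary.PropositionalEquality as ≡
  using (_≡_; refl; sym; trans; cong; cong₂; module ≡-Reasoning)
open import Algebra.Properties.Semiring.Sum +-*-semiring
  using (sum; sum-syntax; sum-cong-≗; sum-replicate-zero; sum-remove; ∑-distrib-+; ∑-comm;
         *-distribˡ-sum; *-distribʳ-sum)
open import Algebra.Properties.CommutativeMonoid.Sum *-1-commutativeMonoid
  using () renaming (sum to product; sum-cong-≗ to product-cong-≗; ∑-distrib-+ to ∏-distrib-*)

χ : ∀ {p} {P : Set p} → Dec P → ℕ
χ P? = if does P? then 1 else 0

χ-yes : ∀ {p} {P : Set p} (P? : Dec P) → P → χ P? ≡ 1
χ-yes P? p = cong (λ b → if b then 1 else 0) (dec-true P? p)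

χ-no : ∀ {p} {P : Set p} (P? : Dec P) → ¬ P → χ P? ≡ 0
χ-no P? ¬p = cong (λ b → if b then 1 else 0) (dec-false P? ¬p)

χ-× : ∀ {p q} {P : Set p} {Q : Set q} (P? : Dec P) (Q? : Dec Q) → χ (P? ×-dec Q?) ≡ χ P? * χ Q?
χ-× P? Q? with does P? | does Q?
... | true  | true  = refl
... | true  | false = refl
... | false | _     = refl

χ-∪ : ∀ {s l r} {S : Set s} {L : Set l} {R : Set r} (S? : Dec S) (L? : Dec L) (R? : Dec R) →
      (S → L ⊎ R) → (L → S) → (R → S) → χ S? + χ L? * χ R? ≡ χ L? + χ R?
χ-∪ S? L? R? S⇒L∪R L⇒S R⇒S with L? | R?
... | yes l | yes _ = cong (_+ 1) (χ-yes S? (L⇒S l))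
... | yes l | no _  = cong (_+ 0) (χ-yes S? (L⇒S l))
... | no _  | yes r = cong (_+ 0) (χ-yes S? (R⇒S r))
... | no ¬l | no ¬r = cong (_+ 0) (χ-no S? λ s → [ ¬l , ¬r ] (S⇒L∪R s))

∑-zero : ∀ m {f : Fin m → ℕ} → (∀ i → f i ≡ 0) → sum f ≡ 0
∑-zero m f≗0 = trans (sum-cong-≗ f≗0) (sum-replicate-zero m)

∑-single : ∀ m {f : Fin m → ℕ} i → f i ≡ 1 → (∀ j → ¬ j ≡ i → f j ≡ 0) → sum f ≡ 1
∑-single (suc m) {f} i fᵢ≡1 others = begin
  sum f                      ≡⟨ sum-remove f ⟩
  f i + sum (removeAt f i)   ≡⟨ cong₂ _+_ fᵢ≡1 (∑-zero m λ j → others _ (punchInᵢ≢i i j)) ⟩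
  1                          ∎
  where open ≡-Reasoning

∑-χ-unique : ∀ m {p} {P : Fin m → Set p} (P? : ∀ i → Dec (P i)) →
             (∀ {i i′} → P i → P i′ → i ≡ i′) → ∑[ i < m ] χ (P? i) ≡ χ (any? P?)
∑-χ-unique m P? unique with any? P?
... | yes (i , pᵢ) = ∑-single m i (χ-yes (P? i) pᵢ) λ j j≢i → χ-no (P? j) λ pⱼ → j≢i (unique pⱼ pᵢ)
... | no ∄       = ∑-zero m λ i → χ-no (P? i) λ pᵢ → ∄ (i , pᵢ)

∑-below : ∀ m (j : Fin m) → ∑[ i < m ] χ (i <? j) ≡ toℕ j
∑-below (suc m) zero    = ∑-zero m λ _ → refl
∑-below (suc m) (suc j) = cong suc (∑-below m j)

∑-between : ∀ m (k j : Fin m) → ∑[ i < m ] (χ (k <? i) * χ (i <? j)) ≡ toℕ j ∸ suc (toℕ k)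
∑-between (suc m) zero    zero    = ∑-zero m λ _ → refl
∑-between (suc m) zero    (suc j) = trans (sum-cong-≗ {m} λ i → +-identityʳ (χ (i <? j))) (∑-below m j)
∑-between (suc m) (suc k) zero    = ∑-zero m λ i → *-zeroʳ (χ (suc k <? suc i))
∑-between (suc m) (suc k) (suc j) = ∑-between m k j

∏-^ : ∀ m a (x : Fin m → ℕ) → product (λ i → a ^ x i) ≡ a ^ sum x
∏-^ zero    a x = refl
∏-^ (suc m) a x = trans (cong (a ^ x zero *_) (∏-^ m a (x ∘ suc))) (sym (^-distribˡ-+-* a (x zero) _))

∏-powers : ∀ m a b (x y : Fin m → ℕ) → product (λ i → a ^ x i * b ^ y i) ≡ a ^ sum x * b ^ sum y
∏-powers m a b x y = trans (∏-distrib-* {m} (λ i → a ^ x i) (λ i → b ^ y i)) (cong₂ _*_ (∏-^ m a x) (∏-^ m b y))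

∑² : ∀ {n} → (Fin n → Fin n → ℕ) → ℕ
∑² {n} f = ∑[ i < n ] ∑[ j < n ] f i j

∑²-cong : ∀ {n} {f g : Fin n → Fin n → ℕ} → (∀ i j → f i j ≡ g i j) → ∑² f ≡ ∑² g
∑²-cong {n} f≗g = sum-cong-≗ {n} λ i → sum-cong-≗ {n} (f≗g i)

∑²-distrib-+ : ∀ {n} (f g : Fin n → Fin n → ℕ) → ∑² (λ i j → f i j + g i j) ≡ ∑² f + ∑² g
∑²-distrib-+ {n} f g = trans (sum-cong-≗ {n} λ i → ∑-distrib-+ {n} (f i) (g i))
  (∑-distrib-+ {n} (λ i → ∑[ j < n ] f i j) (λ i → ∑[ j < n ] g i j))

module _ {a p} {A : Set a} {P : Pred A p} (P? : Decidable P) where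

  sum-map-filter : ∀ (g : A → ℕ) xs → listSum (map g (filter P? xs)) ≡ listSum (map (λ x → χ (P? x) * g x) xs)
  sum-map-filter g []       = refl
  sum-map-filter g (x ∷ xs) with does (P? x)
  ... | true  = cong₂ _+_ (sym (+-identityʳ (g x))) (sum-map-filter g xs)
  ... | false = sum-map-filter g xs

  length-filter : ∀ xs → length (filter P? xs) ≡ listSum (map (χ ∘ P?) xs)
  length-filter []       = refl
  length-filter (x ∷ xs) with does (P? x)
  ... | true  = cong suc (length-filter xs)
  ... | false = length-filter xs

sum-map-cong : ∀ {a} {A : Set a} {g h : A → ℕ} → (∀ x → g x ≡ h x) → ∀ xs → listSum (map g xs) ≡ listSum (map h xs)
sum-map-cong g≗h []       = refl
sum-map-cong g≗h (x ∷ xs) = cong₂ _+_ (g≗h x) (sum-map-cong g≗h xs)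

sum-map-cartesianProduct : ∀ {a b} {A : Set a} {B : Set b} (g : A × B → ℕ) xs ys →
  listSum (map g (cartesianProduct xs ys)) ≡ listSum (map (λ x → listSum (map (λ y → g (x , y)) ys)) xs)
sum-map-cartesianProduct g []       ys = refl
sum-map-cartesianProduct g (x ∷ xs) ys = begin
  listSum (map g (map (x ,_) ys ++ cartesianProduct xs ys))
    ≡⟨ cong listSum (map-++ g (map (x ,_) ys) _) ⟩
  listSum (map g (map (x ,_) ys) ++ map g (cartesianProduct xs ys))
    ≡⟨ listSum-++ (map g (map (x ,_) ys)) _ ⟩
  listSum (map g (map (x ,_) ys)) + listSum (map g (cartesianProduct xs ys))
    ≡⟨ cong₂ _+_ (cong listSum (sym (map-∘ ys))) (sum-map-cartesianProduct g xs ys) ⟩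
  listSum (map (λ y → g (x , y)) ys) + listSum (map (λ x → listSum (map (λ y → g (x , y)) ys)) xs) ∎
  where open ≡-Reasoning

sum-map-allFin : ∀ n (g : Fin n → ℕ) → listSum (map g (allFin n)) ≡ sum g
sum-map-allFin n g = trans (cong listSum (map-tabulate id g)) (sum-tabulate n g)
  where
  sum-tabulate : ∀ n (h : Fin n → ℕ) → listSum (tabulate h) ≡ sum h
  sum-tabulate zero    h = refl
  sum-tabulate (suc n) h = cong (h zero +_) (sum-tabulate n (h ∘ suc))

sum-map-allPairs : ∀ n (g : Fin n × Fin n → ℕ) →
  listSum (map g (cartesianProduct (allFin n) (allFin n))) ≡ ∑² λ i j → g (i , j)
sum-map-allPairs n g = begin
  listSum (map g (cartesianProduct (allFin n) (allFin n)))
    ≡⟨ sum-map-cartesianProduct g (allFin n) (allFin n) ⟩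
  listSum (map (λ i → listSum (map (λ j → g (i , j)) (allFin n))) (allFin n))
    ≡⟨ sum-map-cong (λ i → sum-map-allFin n (λ j → g (i , j))) (allFin n) ⟩
  listSum (map (λ i → sum (λ j → g (i , j))) (allFin n))
    ≡⟨ sum-map-allFin n _ ⟩
  ∑² (λ i j → g (i , j)) ∎
  where open ≡-Reasoning

∑-reverse₃ : ∀ {n} (f : Fin n → Fin n → Fin n → ℕ) →
  ∑[ i < n ] ∑[ j < n ] ∑[ k < n ] f i j k ≡ ∑[ k < n ] ∑[ j < n ] ∑[ i < n ] f i j k
∑-reverse₃ {n} f = begin
  ∑[ i < n ] ∑[ j < n ] ∑[ k < n ] f i j k ≡⟨ ∑-comm {n} {n} _ ⟩
  ∑[ j < n ] ∑[ i < n ] ∑[ k < n ] f i j k ≡⟨ sum-cong-≗ {n} (λ j → ∑-comm {n} {n} _) ⟩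
  ∑[ j < n ] ∑[ k < n ] ∑[ i < n ] f i j k ≡⟨ ∑-comm {n} {n} _ ⟩
  ∑[ k < n ] ∑[ j < n ] ∑[ i < n ] f i j k ∎
  where open ≡-Reasoning

*-sum-sum : ∀ {n} a (f g : Fin n → ℕ) → a * (sum f * sum g) ≡ ∑[ k < n ] ∑[ l < n ] (a * (f k * g l))
*-sum-sum {n} a f g = begin
  a * (sum f * sum g)                          ≡⟨ cong (a *_) (*-distribʳ-sum {n} (sum g) f) ⟩
  a * ∑[ k < n ] (f k * sum g)                 ≡⟨ *-distribˡ-sum {n} a _ ⟩
  ∑[ k < n ] (a * (f k * sum g))               ≡⟨ sum-cong-≗ {n} (λ k → cong (a *_) (*-distribˡ-sum {n} (f k) g)) ⟩
  ∑[ k < n ] (a * ∑[ l < n ] (f k * g l))      ≡⟨ sum-cong-≗ {n} (λ k → *-distribˡ-sum {n} a _) ⟩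
  ∑[ k < n ] ∑[ l < n ] (a * (f k * g l))      ∎
  where open ≡-Reasoning

module Arcs {n : ℕ} (π : SetPartition n) where
  open SetPartition π using (isEquivalence)
  open IsEquivalence isEquivalence using () renaming (sym to ∼-sym; trans to ∼-trans)

  arc-left-unique : ∀ {k k′ j} → Arc π k j → Arc π k′ j → k ≡ k′
  arc-left-unique {k} {k′} (k<j , k∼j , gapₖ) (k′<j , k′∼j , gapₖ′) with <-cmp k k′
  ... | tri< k<k′ _ _ = ⊥-elim (gapₖ k′ k<k′ k′<j (∼-trans k∼j (∼-sym k′∼j)))
  ... | tri≈ _ k≡k′ _ = k≡k′
  ... | tri> _ _ k′<k = ⊥-elim (gapₖ′ k k′<k k<j (∼-trans k′∼j (∼-sym k∼j)))

  arc-right-unique : ∀ {i l l′} → Arc π i l → Arc π i l′ → l ≡ l′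
  arc-right-unique {i} {l} {l′} (i<l , i∼l , gapₗ) (i<l′ , i∼l′ , gapₗ′) with <-cmp l l′
  ... | tri< l<l′ _ _ = ⊥-elim (gapₗ′ l i<l l<l′ i∼l)
  ... | tri≈ _ l≡l′ _ = l≡l′
  ... | tri> _ _ l′<l = ⊥-elim (gapₗ l′ i<l′ l′<l i∼l′)

  arc⇒regular : ∀ {i j} → Arc π i j → Regular π i j
  arc⇒regular arc = proj₁ arc
    , (λ { (k , k<i , arc′) → <-irrefl (arc-left-unique arc′ arc) k<i })
    , (λ { (l , j<l , arc′) → <-irrefl (arc-right-unique arc arc′) j<l })

  LeftBlocked RightBlocked : Fin n → Fin n → Set
  LeftBlocked  i j = ∃[ k ] (k < i × Arc π k j)
  RightBlocked i j = ∃[ l ] (j < l × Arc π i l)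

  leftBlocked? : ∀ i j → Dec (LeftBlocked i j)
  leftBlocked? i j = any? λ k → (k <? i) ×-dec Arc? π k j

  rightBlocked? : ∀ i j → Dec (RightBlocked i j)
  rightBlocked? i j = any? λ l → (j <? l) ×-dec Arc? π i l

  regular? : ∀ i j → Dec (Regular π i j)
  regular? i j = (i <? j) ×-dec (¬? (leftBlocked? i j) ×-dec ¬? (rightBlocked? i j))

  singular? : ∀ i j → Dec (Singular π i j)
  singular? i j = (i <? j) ×-dec ¬? (regular? i j)

  ⟦_<_⟧ : Fin n → Fin n → ℕ
  ⟦ i < j ⟧ = χ (i <? j)

  α σ : Fin n → Fin n → ℕ
  α i j = χ (Arc? π i j)
  σ i j = χ (singular? i j)

  -- By uniqueness of arcs, the blocking indicators are sums over arcs.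
  χ-leftBlocked : ∀ i j → χ (leftBlocked? i j) ≡ ∑[ k < n ] (⟦ k < i ⟧ * α k j)
  χ-leftBlocked i j = sym (trans (sum-cong-≗ {n} λ k → sym (χ-× (k <? i) (Arc? π k j)))
    (∑-χ-unique n _ λ (_ , arc) (_ , arc′) → arc-left-unique arc arc′))

  χ-rightBlocked : ∀ i j → χ (rightBlocked? i j) ≡ ∑[ l < n ] (⟦ j < l ⟧ * α i l)
  χ-rightBlocked i j = sym (trans (sum-cong-≗ {n} λ l → sym (χ-× (j <? l) (Arc? π i l)))
    (∑-χ-unique n _ λ (_ , arc) (_ , arc′) → arc-right-unique arc arc′))

  singular-inclusion-exclusion : ∀ {i j} → i < j →
    σ i j + χ (leftBlocked? i j) * χ (rightBlocked? i j) ≡ χ (leftBlocked? i j) + χ (rightBlocked? i j)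
  singular-inclusion-exclusion {i} {j} i<j =
    χ-∪ (singular? i j) (leftBlocked? i j) (rightBlocked? i j) singular⇒blocked
        (λ left  → i<j , λ reg → proj₁ (proj₂ reg) left)
        (λ right → i<j , λ reg → proj₂ (proj₂ reg) right)
    where
    singular⇒blocked : Singular π i j → LeftBlocked i j ⊎ RightBlocked i j
    singular⇒blocked (_ , ¬reg) with leftBlocked? i j | rightBlocked? i j
    ... | yes left | _         = inj₁ left
    ... | no _     | yes right = inj₂ right
    ... | no ¬left | no ¬right = ⊥-elim (¬reg (i<j , ¬left , ¬right))

  -- The same identity for all pairs, weighted by [i < j] (σ vanishes when i ≮ j).
  singular-split : ∀ i j → σ i j + ⟦ i < j ⟧ * (χ (leftBlocked? i j) * χ (rightBlocked? i j))
                         ≡ ⟦ i < j ⟧ * χ (leftBlocked? i j) + ⟦ i < j ⟧ * χ (rightBlocked? i j)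
  singular-split i j = split (i <? j)
    where
    L R : ℕ
    L = χ (leftBlocked? i j)
    R = χ (rightBlocked? i j)
    split : (i<j? : Dec (i < j)) → σ i j + χ i<j? * (L * R) ≡ χ i<j? * L + χ i<j? * R
    split (yes i<j) = begin
      σ i j + 1 * (L * R)  ≡⟨ cong (σ i j +_) (*-identityˡ (L * R)) ⟩
      σ i j + L * R        ≡⟨ singular-inclusion-exclusion i<j ⟩
      L + R                ≡⟨ sym (cong₂ _+_ (*-identityˡ L) (*-identityˡ R)) ⟩
      1 * L + 1 * R        ∎
      where open ≡-Reasoning
    split (no i≮j) = trans (+-identityʳ (σ i j)) (χ-no (singular? i j) (i≮j ∘ proj₁))

  gaps : ℕ
  gaps = ∑² λ k j → α k j * (toℕ j ∸ suc (toℕ k))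

  crossings : ℕ
  crossings = ∑² λ k j → α k j * ∑² λ i l → α i l * (⟦ k < i ⟧ * (⟦ i < j ⟧ * ⟦ j < l ⟧))

  -- Left-blocked pairs (i , j) correspond to an arc (k , j) and k < i < j.
  left-blocked-count : ∑² (λ i j → ⟦ i < j ⟧ * χ (leftBlocked? i j)) ≡ gaps
  left-blocked-count = begin
    ∑² (λ i j → ⟦ i < j ⟧ * χ (leftBlocked? i j))
      ≡⟨ ∑²-cong (λ i j → cong (⟦ i < j ⟧ *_) (χ-leftBlocked i j)) ⟩
    ∑² (λ i j → ⟦ i < j ⟧ * ∑[ k < n ] (⟦ k < i ⟧ * α k j))
      ≡⟨ ∑²-cong (λ i j → *-distribˡ-sum {n} ⟦ i < j ⟧ _) ⟩
    ∑[ i < n ] ∑[ j < n ] ∑[ k < n ] (⟦ i < j ⟧ * (⟦ k < i ⟧ * α k j))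
      ≡⟨ ∑-reverse₃ {n} _ ⟩
    ∑[ k < n ] ∑[ j < n ] ∑[ i < n ] (⟦ i < j ⟧ * (⟦ k < i ⟧ * α k j))
      ≡⟨ ∑²-cong (λ k j → sum-cong-≗ {n} λ i → rearrange ⟦ i < j ⟧ ⟦ k < i ⟧ (α k j)) ⟩
    ∑[ k < n ] ∑[ j < n ] ∑[ i < n ] (α k j * (⟦ k < i ⟧ * ⟦ i < j ⟧))
      ≡⟨ ∑²-cong (λ k j → sym (*-distribˡ-sum {n} (α k j) _)) ⟩
    ∑² (λ k j → α k j * ∑[ i < n ] (⟦ k < i ⟧ * ⟦ i < j ⟧))
      ≡⟨ ∑²-cong (λ k j → cong (α k j *_) (∑-between n k j)) ⟩
    gaps ∎
    where
    open ≡-Reasoning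
    rearrange : ∀ x y z → x * (y * z) ≡ z * (y * x)
    rearrange = solve-∀

  -- Right-blocked pairs (i , j) correspond to an arc (i , l) and i < j < l.
  right-blocked-count : ∑² (λ i j → ⟦ i < j ⟧ * χ (rightBlocked? i j)) ≡ gaps
  right-blocked-count = begin
    ∑² (λ i j → ⟦ i < j ⟧ * χ (rightBlocked? i j))
      ≡⟨ ∑²-cong (λ i j → cong (⟦ i < j ⟧ *_) (χ-rightBlocked i j)) ⟩
    ∑² (λ i j → ⟦ i < j ⟧ * ∑[ l < n ] (⟦ j < l ⟧ * α i l))
      ≡⟨ ∑²-cong (λ i j → *-distribˡ-sum {n} ⟦ i < j ⟧ _) ⟩
    ∑[ i < n ] ∑[ j < n ] ∑[ l < n ] (⟦ i < j ⟧ * (⟦ j < l ⟧ * α i l))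
      ≡⟨ sum-cong-≗ {n} (λ i → ∑-comm {n} {n} _) ⟩
    ∑[ i < n ] ∑[ l < n ] ∑[ j < n ] (⟦ i < j ⟧ * (⟦ j < l ⟧ * α i l))
      ≡⟨ ∑²-cong (λ i l → sum-cong-≗ {n} λ j → rearrange ⟦ i < j ⟧ ⟦ j < l ⟧ (α i l)) ⟩
    ∑[ i < n ] ∑[ l < n ] ∑[ j < n ] (α i l * (⟦ i < j ⟧ * ⟦ j < l ⟧))
      ≡⟨ ∑²-cong (λ i l → sym (*-distribˡ-sum {n} (α i l) _)) ⟩
    ∑² (λ i l → α i l * ∑[ j < n ] (⟦ i < j ⟧ * ⟦ j < l ⟧))
      ≡⟨ ∑²-cong (λ i l → cong (α i l *_) (∑-between n i l)) ⟩
    gaps ∎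
    where
    open ≡-Reasoning
    rearrange : ∀ x y z → x * (y * z) ≡ z * (x * y)
    rearrange = solve-∀

  -- Doubly blocked pairs (i , j) correspond to crossing arcs (k , j), (i , l).
  doubly-blocked-count :
    ∑² (λ i j → ⟦ i < j ⟧ * (χ (leftBlocked? i j) * χ (rightBlocked? i j))) ≡ crossings
  doubly-blocked-count = begin
    ∑² (λ i j → ⟦ i < j ⟧ * (χ (leftBlocked? i j) * χ (rightBlocked? i j)))
      ≡⟨ ∑²-cong (λ i j → cong (⟦ i < j ⟧ *_) (cong₂ _*_ (χ-leftBlocked i j) (χ-rightBlocked i j))) ⟩
    ∑² (λ i j → ⟦ i < j ⟧ * (∑[ k < n ] (⟦ k < i ⟧ * α k j) * ∑[ l < n ] (⟦ j < l ⟧ * α i l)))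
      ≡⟨ ∑²-cong (λ i j → *-sum-sum {n} ⟦ i < j ⟧ _ _) ⟩
    ∑[ i < n ] ∑[ j < n ] ∑[ k < n ] ∑[ l < n ] (⟦ i < j ⟧ * (⟦ k < i ⟧ * α k j * (⟦ j < l ⟧ * α i l)))
      ≡⟨ ∑-reverse₃ {n} _ ⟩
    ∑[ k < n ] ∑[ j < n ] ∑[ i < n ] ∑[ l < n ] (⟦ i < j ⟧ * (⟦ k < i ⟧ * α k j * (⟦ j < l ⟧ * α i l)))
      ≡⟨ ∑²-cong (λ k j → ∑²-cong λ i l → rearrange ⟦ i < j ⟧ ⟦ k < i ⟧ (α k j) ⟦ j < l ⟧ (α i l)) ⟩
    ∑[ k < n ] ∑[ j < n ] ∑² (λ i l → α k j * (α i l * (⟦ k < i ⟧ * (⟦ i < j ⟧ * ⟦ j < l ⟧))))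
      ≡⟨ ∑²-cong (λ k j → sym (∑²-factor (α k j) _)) ⟩
    crossings ∎
    where
    open ≡-Reasoning
    rearrange : ∀ x y z u v → x * (y * z * (u * v)) ≡ z * (v * (y * (x * u)))
    rearrange = solve-∀
    ∑²-factor : ∀ a (f : Fin n → Fin n → ℕ) → a * ∑² f ≡ ∑² (λ i l → a * f i l)
    ∑²-factor a f = trans (*-distribˡ-sum {n} a _) (sum-cong-≗ {n} λ i → *-distribˡ-sum {n} a (f i))

  singular-count : ∑² σ + crossings ≡ gaps + gaps
  singular-count = begin
    ∑² σ + crossings
      ≡⟨ cong (∑² σ +_) (sym doubly-blocked-count) ⟩
    ∑² σ + ∑² (λ i j → ⟦ i < j ⟧ * (χ (leftBlocked? i j) * χ (rightBlocked? i j)))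
      ≡⟨ sym (∑²-distrib-+ {n} σ _) ⟩
    ∑² (λ i j → σ i j + ⟦ i < j ⟧ * (χ (leftBlocked? i j) * χ (rightBlocked? i j)))
      ≡⟨ ∑²-cong singular-split ⟩
    ∑² (λ i j → ⟦ i < j ⟧ * χ (leftBlocked? i j) + ⟦ i < j ⟧ * χ (rightBlocked? i j))
      ≡⟨ ∑²-distrib-+ {n} _ _ ⟩
    ∑² (λ i j → ⟦ i < j ⟧ * χ (leftBlocked? i j)) + ∑² (λ i j → ⟦ i < j ⟧ * χ (rightBlocked? i j))
      ≡⟨ cong₂ _+_ left-blocked-count right-blocked-count ⟩
    gaps + gaps ∎
    where open ≡-Reasoning

  isArc? : ∀ (p : Fin n × Fin n) → Dec (Arc π (proj₁ p) (proj₂ p))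
  isArc? (i , j) = Arc? π i j

  d-as-sum : d π ≡ ∑² α
  d-as-sum = trans (length-filter isArc? (allPairs π)) (sum-map-allPairs n _)

  dim-as-sum : dim π ≡ gaps + d π
  dim-as-sum = begin
    dim π
      ≡⟨ sum-map-filter isArc? _ (allPairs π) ⟩
    listSum (map (λ p → χ (isArc? p) * (toℕ (proj₂ p) ∸ toℕ (proj₁ p))) (allPairs π))
      ≡⟨ sum-map-allPairs n _ ⟩
    ∑² (λ i j → α i j * (toℕ j ∸ toℕ i))
      ≡⟨ ∑²-cong (λ i j → arc-length (Arc? π i j)) ⟩
    ∑² (λ i j → α i j * (toℕ j ∸ suc (toℕ i)) + α i j)
      ≡⟨ ∑²-distrib-+ {n} _ _ ⟩
    gaps + ∑² α
      ≡⟨ cong (gaps +_) (sym d-as-sum) ⟩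
    gaps + d π ∎
    where
    open ≡-Reasoning
    arc-length : ∀ {i j} (arc? : Dec (Arc π i j)) →
      χ arc? * (toℕ j ∸ toℕ i) ≡ χ arc? * (toℕ j ∸ suc (toℕ i)) + χ arc?
    arc-length (yes (i<j , _)) = trans (cong (1 *_) (+-∸-assoc 1 i<j)) (shift _)
      where
      shift : ∀ x → 1 * suc x ≡ 1 * x + 1
      shift = solve-∀
    arc-length (no _) = refl

  crs-as-sum : crs π ≡ crossings
  crs-as-sum = begin
    crs π
      ≡⟨ length-filter (Crossing? π) (cartesianProduct (arcs π) (arcs π)) ⟩
    listSum (map (χ ∘ Crossing? π) (cartesianProduct (arcs π) (arcs π)))
      ≡⟨ sum-map-cartesianProduct _ (arcs π) (arcs π) ⟩
    listSum (map (λ x → listSum (map (crossing x) (arcs π))) (arcs π))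
      ≡⟨ sum-map-filter isArc? _ (allPairs π) ⟩
    listSum (map (λ x → χ (isArc? x) * listSum (map (crossing x) (arcs π))) (allPairs π))
      ≡⟨ sum-map-cong (λ x → cong (χ (isArc? x) *_) (sum-map-filter isArc? _ (allPairs π))) (allPairs π) ⟩
    listSum (map (λ x → χ (isArc? x) * listSum (map (λ y → χ (isArc? y) * crossing x y) (allPairs π))) (allPairs π))
      ≡⟨ sum-map-allPairs n _ ⟩
    ∑² (λ k j → α k j * listSum (map (λ y → χ (isArc? y) * crossing (k , j) y) (allPairs π)))
      ≡⟨ ∑²-cong (λ k j → cong (α k j *_) (sum-map-allPairs n _)) ⟩
    ∑² (λ k j → α k j * ∑² λ i l → α i l * crossing (k , j) (i , l))
      ≡⟨ ∑²-cong (λ k j → cong (α k j *_) (∑²-cong λ i l → cong (α i l *_) (χ-crossing k j i l))) ⟩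
    crossings ∎
    where
    open ≡-Reasoning
    crossing : Fin n × Fin n → Fin n × Fin n → ℕ
    crossing x y = χ (Crossing? π (x , y))
    χ-crossing : ∀ k j i l → crossing (k , j) (i , l) ≡ ⟦ k < i ⟧ * (⟦ i < j ⟧ * ⟦ j < l ⟧)
    χ-crossing k j i l = trans (χ-× (k <? i) ((i <? j) ×-dec (j <? l))) (cong (⟦ k < i ⟧ *_) (χ-× (i <? j) (j <? l)))

  singular-pairs : ∑² σ ≡ 2 * dim π ∸ 2 * d π ∸ crs π
  singular-pairs = sym (begin
    2 * dim π ∸ 2 * d π ∸ crs π
      ≡⟨ cong (λ x → 2 * x ∸ 2 * d π ∸ crs π) dim-as-sum ⟩
    2 * (gaps + d π) ∸ 2 * d π ∸ crs π
      ≡⟨ cong (λ x → x ∸ 2 * d π ∸ crs π) (*-distribˡ-+ 2 gaps (d π)) ⟩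
    2 * gaps + 2 * d π ∸ 2 * d π ∸ crs π
      ≡⟨ cong (_∸ crs π) (m+n∸n≡m (2 * gaps) (2 * d π)) ⟩
    2 * gaps ∸ crs π
      ≡⟨ cong₂ _∸_ (cong (gaps +_) (+-identityʳ gaps)) crs-as-sum ⟩
    gaps + gaps ∸ crossings
      ≡⟨ cong (_∸ crossings) (sym singular-count) ⟩
    ∑² σ + crossings ∸ crossings
      ≡⟨ m+n∸n≡m (∑² σ) crossings ⟩
    ∑² σ ∎)
    where open ≡-Reasoning

module _ {s₁ s₂ t₁ t₂ : Level} {S : Setoid s₁ s₂} {T : Setoid t₁ t₂} where
  private
    module S = Setoid S
    module T = Setoid T

  mkInverse : (to : S.Carrier → T.Carrier) (from : T.Carrier → S.Carrier) →
    (∀ {x y} → x S.≈ y → to x T.≈ to y) → (∀ {x y} → x T.≈ y → from x S.≈ from y) →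
    (∀ y → to (from y) T.≈ y) → (∀ x → from (to x) S.≈ x) → Inverse S T
  mkInverse to from to-cong from-cong to∘from from∘to = record
    { to = to ; from = from ; to-cong = to-cong ; from-cong = from-cong
    ; inverse = (λ {y} x≈from-y → T.trans (to-cong x≈from-y) (to∘from y))
              , (λ {x} y≈to-x → S.trans (from-cong y≈to-x) (from∘to x)) }

Π-setoid : ∀ {a b} m → (Fin m → Setoid a b) → Setoid a b
Π-setoid m S = record
  { Carrier       = (i : Fin m) → Setoid.Carrier (S i)
  ; _≈_           = λ f g → ∀ i → Setoid._≈_ (S i) (f i) (g i)
  ; isEquivalence = record
    { refl  = λ i → Setoid.refl (S i)
    ; sym   = λ f≈g i → Setoid.sym (S i) (f≈g i)
    ; trans = λ f≈g g≈h i → Setoid.trans (S i) (f≈g i) (g≈h i) } }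

-- Multiplication principle: if S i has c i elements, then the product
-- of the S i has ∏ c i elements (via mixed-radix encoding with combine).
Π-card : ∀ {a b} m (S : Fin m → Setoid a b) (c : Fin m → ℕ) →
  (∀ i → Inverse (S i) (≡.setoid (Fin (c i)))) → Inverse (Π-setoid m S) (≡.setoid (Fin (product c)))
Π-card zero S c _ = mkInverse (λ _ → zero) (λ _ ()) (λ _ → refl) (λ _ ()) unique (λ _ ())
  where
  unique : ∀ (y : Fin 1) → zero ≡ y
  unique zero = refl
Π-card (suc m) S c cards = mkInverse to from to-cong from-cong to∘from from∘to
  where
  module Head = Inverse (cards zero)
  module Tail = Inverse (Π-card m (S ∘ suc) (c ∘ suc) (cards ∘ suc))
  module Π = Setoid (Π-setoid (suc m) S)
  k : ℕ
  k = product (c ∘ suc)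

  to : Π.Carrier → Fin (product c)
  to f = combine (Head.to (f zero)) (Tail.to (f ∘ suc))

  from : Fin (product c) → Π.Carrier
  from y zero    = Head.from (proj₁ (remQuot {c zero} k y))
  from y (suc i) = Tail.from (proj₂ (remQuot {c zero} k y)) i

  to-cong : ∀ {f g} → f Π.≈ g → to f ≡ to g
  to-cong f≈g = cong₂ combine (Head.to-cong (f≈g zero)) (Tail.to-cong (f≈g ∘ suc))

  from-cong : ∀ {x y} → x ≡ y → from x Π.≈ from y
  from-cong refl = Π.refl

  to∘from : ∀ y → to (from y) ≡ y
  to∘from y = trans (cong₂ combine (Head.strictlyInverseˡ _) (Tail.strictlyInverseˡ _)) (combine-remQuot {c zero} k y)

  from∘to : ∀ f → from (to f) Π.≈ f
  from∘to f zero    = Setoid.trans (S zero)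
    (Head.from-cong (cong proj₁ (remQuot-combine {c zero} {k} _ _))) (Head.strictlyInverseʳ (f zero))
  from∘to f (suc i) = Setoid.trans (S (suc i))
    (Tail.from-cong (cong proj₂ (remQuot-combine {c zero} {k} _ _)) i) (Tail.strictlyInverseʳ (f ∘ suc) i)

module Entries {c ℓ : Level} {q′ : ℕ} (K : FiniteField c ℓ (suc q′)) where
  open FiniteField K using (Carrier; _≈_; 0#; 1#; setoid; card)
  open Setoid setoid using () renaming (refl to ≈-refl; sym to ≈-sym; trans to ≈-trans)
  module Card = Inverse (Bijection⇒Inverse card)

  data Constraint : Set c where
    nonzero unconstrained : Constraint
    equals                : Carrier → Constraint

  Sat : Constraint → Carrier → Set ℓ
  Sat nonzero       x = ¬ (x ≈ 0#)
  Sat unconstrained x = Lift ℓ ⊤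
  Sat (equals a)    x = x ≈ a

  count : Constraint → ℕ
  count nonzero       = q′
  count unconstrained = suc q′
  count (equals _)    = 1

  Solutions : Constraint → Setoid (c ⊔ ℓ) ℓ
  Solutions κ = On.setoid {B = Σ Carrier (Sat κ)} setoid proj₁

  -- Solutions κ has count κ elements; the nonzero elements are counted
  -- by deleting the code of 0# from Fin (suc q′).
  solutions-card : ∀ κ → Inverse (Solutions κ) (≡.setoid (Fin (count κ)))
  solutions-card nonzero = mkInverse to from
    (λ x≈y → punchOut-cong zero₀ (Card.to-cong x≈y)) (λ { refl → ≈-refl })
    (λ y → trans (punchOut-cong zero₀ (Card.strictlyInverseˡ (punchIn zero₀ y))) (punchOut-punchIn zero₀))
    (λ (x , _) → ≈-trans (Card.from-cong (punchIn-punchOut _)) (Card.strictlyInverseʳ x))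
    where
    zero₀ : Fin (suc q′)
    zero₀ = Card.to 0#
    to : Σ Carrier (Sat nonzero) → Fin q′
    to (x , x≉0) = punchOut {i = zero₀} {j = Card.to x} λ 0≡x → x≉0 (Bijection.injective card (sym 0≡x))
    from : Fin q′ → Σ Carrier (Sat nonzero)
    from y = Card.from (punchIn zero₀ y)
           , λ x≈0 → punchInᵢ≢i zero₀ y (trans (sym (Card.strictlyInverseˡ _)) (Card.to-cong x≈0))
  solutions-card unconstrained = mkInverse (Card.to ∘ proj₁) (λ y → Card.from y , lift tt)
    Card.to-cong (λ { refl → ≈-refl }) Card.strictlyInverseˡ (Card.strictlyInverseʳ ∘ proj₁)
  solutions-card (equals a) = mkInverse (λ _ → zero) (λ _ → a , ≈-refl)
    (λ _ → refl) (λ _ → ≈-refl) (λ { zero → refl }) (λ (_ , x≈a) → ≈-sym x≈a)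

  module _ {n : ℕ} (π : SetPartition n) where
    open Arcs π using (regular?; singular?; arc⇒regular; α; σ; d-as-sum; singular-pairs)

    data Position (i j : Fin n) : Set where
      diagonal : i ≡ j → Position i j
      below    : j < i → Position i j
      arc      : Arc π i j → Position i j
      regular  : Regular π i j → ¬ Arc π i j → Position i j
      singular : Singular π i j → Position i j

    position : ∀ i j → Position i j
    position i j with <-cmp i j
    ... | tri≈ _ i≡j _ = diagonal i≡j
    ... | tri> _ _ j<i = below j<i
    ... | tri< i<j _ _ with Arc? π i j | regular? i j
    ...   | yes a  | _       = arc a
    ...   | no ¬a  | yes reg = regular reg ¬a
    ...   | no _   | no ¬reg = singular (i<j , ¬reg)

    constraint : ∀ {i j} → Position i j → Constraint
    constraint (diagonal _)  = equals 1#
    constraint (below _)     = equals 0#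
    constraint (arc _)       = nonzero
    constraint (regular _ _) = equals 0#
    constraint (singular _)  = unconstrained

    constraint-diagonal : ∀ {i} (p : Position i i) → constraint p ≡ equals 1#
    constraint-diagonal (diagonal _)          = refl
    constraint-diagonal (below i<i)           = ⊥-elim (<-irrefl refl i<i)
    constraint-diagonal (arc (i<i , _))       = ⊥-elim (<-irrefl refl i<i)
    constraint-diagonal (regular (i<i , _) _) = ⊥-elim (<-irrefl refl i<i)
    constraint-diagonal (singular (i<i , _))  = ⊥-elim (<-irrefl refl i<i)

    constraint-below : ∀ {i j} → j < i → (p : Position i j) → constraint p ≡ equals 0#
    constraint-below j<i (diagonal refl)       = ⊥-elim (<-irrefl refl j<i)
    constraint-below j<i (below _)             = refl
    constraint-below j<i (arc (i<j , _))       = ⊥-elim (<-asym j<i i<j)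
    constraint-below j<i (regular (i<j , _) _) = ⊥-elim (<-asym j<i i<j)
    constraint-below j<i (singular (i<j , _))  = ⊥-elim (<-asym j<i i<j)

    constraint-arc : ∀ {i j} → Arc π i j → (p : Position i j) → constraint p ≡ nonzero
    constraint-arc (i<i , _) (diagonal refl)       = ⊥-elim (<-irrefl refl i<i)
    constraint-arc (i<j , _) (below j<i)           = ⊥-elim (<-asym j<i i<j)
    constraint-arc _         (arc _)               = refl
    constraint-arc a         (regular _ ¬a)        = ⊥-elim (¬a a)
    constraint-arc a         (singular (_ , ¬reg)) = ⊥-elim (¬reg (arc⇒regular a))

    constraint-regular : ∀ {i j} → Regular π i j → ¬ Arc π i j → (p : Position i j) → constraint p ≡ equals 0#
    constraint-regular (i<i , _) _  (diagonal refl)       = ⊥-elim (<-irrefl refl i<i)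
    constraint-regular (i<j , _) _  (below j<i)           = ⊥-elim (<-asym j<i i<j)
    constraint-regular _         ¬a (arc a)               = ⊥-elim (¬a a)
    constraint-regular _         _  (regular _ _)         = refl
    constraint-regular reg       _  (singular (_ , ¬reg)) = ⊥-elim (¬reg reg)

    exponents : ∀ {i j x y} → α i j ≡ x → σ i j ≡ y → q′ ^ x * suc q′ ^ y ≡ q′ ^ α i j * suc q′ ^ σ i j
    exponents α≡x σ≡y = cong₂ (λ x y → q′ ^ x * suc q′ ^ y) (sym α≡x) (sym σ≡y)

    count-position : ∀ {i j} (p : Position i j) → count (constraint p) ≡ q′ ^ α i j * suc q′ ^ σ i j
    count-position {i} (diagonal refl) =
      exponents {i} {i} (χ-no (Arc? π i i) (<-irrefl refl ∘ proj₁)) (χ-no (singular? i i) (<-irrefl refl ∘ proj₁))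
    count-position {i} {j} (below j<i) =
      exponents {i} {j} (χ-no (Arc? π i j) (<-asym j<i ∘ proj₁)) (χ-no (singular? i j) (<-asym j<i ∘ proj₁))
    count-position {i} {j} (arc a) = trans (sym (trans (*-identityʳ (q′ * 1)) (*-identityʳ q′)))
      (exponents {i} {j} (χ-yes (Arc? π i j) a) (χ-no (singular? i j) λ (_ , ¬reg) → ¬reg (arc⇒regular a)))
    count-position {i} {j} (regular reg ¬a) =
      exponents {i} {j} (χ-no (Arc? π i j) ¬a) (χ-no (singular? i j) λ (_ , ¬reg) → ¬reg reg)
    count-position {i} {j} (singular sing) = trans (sym (trans (*-identityˡ (suc q′ * 1)) (*-identityʳ (suc q′))))
      (exponents {i} {j} (χ-no (Arc? π i j) λ a → proj₂ sing (arc⇒regular a)) (χ-yes (singular? i j) sing))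

    InJ⇒constraints : ∀ {A : Matrix K} → InJ K π A → ∀ i j → Sat (constraint (position i j)) (A i j)
    InJ⇒constraints {A} ((diag , lower) , arcs≉0 , regular≈0) i j = at (position i j)
      where
      at : (p : Position i j) → Sat (constraint p) (A i j)
      at (diagonal refl)  = diag i
      at (below j<i)      = lower i j j<i
      at (arc a)          = arcs≉0 i j a
      at (regular reg ¬a) = regular≈0 i j reg ¬a
      at (singular _)     = lift tt

    constraints⇒InJ : ∀ {A : Matrix K} → (∀ i j → Sat (constraint (position i j)) (A i j)) → InJ K π A
    constraints⇒InJ {A} sat =
      ( (λ i → pinned (constraint-diagonal (position i i)) (sat i i))
      , (λ i j j<i → pinned (constraint-below j<i (position i j)) (sat i j)) )
      , (λ i j a → pinned (constraint-arc a (position i j)) (sat i j))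
      , (λ i j reg ¬a → pinned (constraint-regular reg ¬a (position i j)) (sat i j))
      where
      pinned : ∀ {i j} {p : Position i j} {κ} → constraint p ≡ κ → Sat (constraint p) (A i j) → Sat κ (A i j)
      pinned {i} {j} = ≡.subst (λ κ → Sat κ (A i j))

    Entries : Setoid (c ⊔ ℓ) ℓ
    Entries = Π-setoid n λ i → Π-setoid n λ j → Solutions (constraint (position i j))

    J≅Entries : Inverse (J-setoid K π) Entries
    J≅Entries = mkInverse
      (λ (A , A∈J) i j → A i j , InJ⇒constraints A∈J i j)
      (λ g → (λ i j → proj₁ (g i j)) , constraints⇒InJ (λ i j → proj₂ (g i j)))
      (λ A≈B → A≈B) (λ g≈h → g≈h) (λ _ _ _ → ≈-refl) (λ _ _ _ → ≈-refl)

    J-card : Inverse (J-setoid K π) (≡.setoid (Fin (product λ i → product λ j → count (constraint (position i j)))))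
    J-card = Compose.inverse J≅Entries
      (Π-card n _ _ λ i → Π-card n _ _ λ j → solutions-card (constraint (position i j)))

    J-size : (product λ i → product λ j → count (constraint (position i j)))
           ≡ q′ ^ d π * suc q′ ^ (2 * dim π ∸ 2 * d π ∸ crs π)
    J-size = begin
      (product λ i → product λ j → count (constraint (position i j)))
        ≡⟨ product-cong-≗ {n} (λ i → product-cong-≗ {n} λ j → count-position (position i j)) ⟩
      (product λ i → product λ j → q′ ^ α i j * suc q′ ^ σ i j)
        ≡⟨ product-cong-≗ {n} (λ i → ∏-powers n q′ (suc q′) (α i) (σ i)) ⟩
      (product λ i → q′ ^ sum (α i) * suc q′ ^ sum (σ i))
        ≡⟨ ∏-powers n q′ (suc q′) _ _ ⟩
      q′ ^ ∑² α * suc q′ ^ ∑² σ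
        ≡⟨ cong₂ (λ x y → q′ ^ x * suc q′ ^ y) (sym d-as-sum) singular-pairs ⟩
      q′ ^ d π * suc q′ ^ (2 * dim π ∸ 2 * d π ∸ crs π) ∎
      where open ≡-Reasoning

-- The main theorem: |J_π| = (q - 1)^d(π) · q^(2 dim(π) - 2 d(π) - crs(π)).
-- A field has an element, so q ≠ 0; for q = suc q′ the count is J-card
-- rewritten by J-size.
mainTheorem15 : ∀ {c ℓ : Level} (q : ℕ) (K : FiniteField c ℓ q) (n : ℕ) (π : SetPartition n) →
    HasCard (J-setoid K π) ((q ∸ 1) ^ d π * q ^ (2 * dim π ∸ 2 * d π ∸ crs π))
mainTheorem15 zero     K n π with () ← Bijection.to (FiniteField.card K) (FiniteField.0# K)
mainTheorem15 (suc q′) K n π =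
  ≡.subst (HasCard (J-setoid K π)) (J-size K π) (Inverse⇒Bijection (J-card K π))
  where open Entries
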